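{- Let $\sigma$ be the function on finite disjoint unions of paths defined below (the misère selective outcome function). For every $n\ge 0$: 1. $\sigma(P_{7n+1})=\sigma(P_{7n+2})=0$; 2. $\sigma(P_{7n+a})=1$ for every $a$ with $3\le a\le 7$.
   Context: For $n\ge 0$, $P_n$ denotes the path on $n$ vertices ($P_0$ is the empty graph). A Node-Kayles move on a path $P_k$ with $k\ge 1$ chooses a vertex and deletes it together with its neighbours. The set $O(P_k)$ of options of $P_k$ is: $O(P_0)=\emptyset$; $O(P_1)=O(P_2)=\{P_0\}$; $O(P_3)=\{P_0,P_1\}$; and, for $k\ge 4$, $$O(P_k)=\{P_{k-2},P_{k-3}\}\cup\{P_i\cup P_j:\ j\ge i\ge 1,\ i+j=k-3\}.$$ The function $\sigma$, which records the outcome for selective compound Node-Kayles under misère play with $1$ meaning $\mathcal{N}$ and $0$ meaning $\mathcal{P}$, is the Boolean function defined recursively by: - $\sigma(P_0)=1$; - $\sigma(P_k)=1-\min\{\sigma(G'):G'\in O(P_k)\}$ for $k\ge1$; - $\sigma(P_i\cup P_j)=\sigma(P_i)\vee\sigma(P_j)$ (Boolean OR) for nonempty paths $P_i,P_j$. -}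

module Defs where

open import Data.Nat using (ℕ; zero; suc; _∸_; _≤ᵇ_; _+_)
open import Data.Bool using (Bool; true; false; not; _∨_; _∧_; if_then_else_)
open import Data.List using (List; []; _∷_; map; filterᵇ; upTo; foldr)

-- Positions reachable from a single path: a path P_k, or a union P_i ∪ P_j.
data Pos : Set where
  path  : ℕ → Pos
  union : ℕ → ℕ → Pos

-- O(P_k), exactly as in the paper.
-- Unions P_i ∪ P_j with j ≥ i ≥ 1 and i + j = m (here m = k - 3).
unions : ℕ → List Pos
unions m = map (λ i → union i (m ∸ i))
               (filterᵇ (λ i → (1 ≤ᵇ i) ∧ (i ≤ᵇ (m ∸ i)) ∧ (1 ≤ᵇ (m ∸ i))) (upTo (suc m)))

options : ℕ → List Pos
options 0 = []
options 1 = path 0 ∷ []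
options 2 = path 0 ∷ []
options 3 = path 0 ∷ path 1 ∷ []
options (suc (suc (suc (suc n)))) = path (2 + n) ∷ path (1 + n) ∷ unions (1 + n)

valPos : (ℕ → Bool) → Pos → Bool
valPos f (path k)    = f k
valPos f (union i j) = f i ∨ f j

-- Boolean minimum over a list (min = conjunction; min ∅ = 1, never used for k ≥ 1).
minB : List Bool → Bool
minB = foldr _∧_ true

step : (ℕ → Bool) → ℕ → Bool
step f k = not (minB (map (valPos f) (options k)))

-- Course-of-values table: table n m = σ(P_m) for all m ≤ n.
table : ℕ → ℕ → Bool
table zero    m = true
table (suc n) m = if m ≤ᵇ n then table n m else step (table n) (suc n)

-- σ(P_k) (true = 1 = 𝒩, false = 0 = 𝒫).
σP : ℕ → Bool
σP k = table k k

σU : ℕ → ℕ → Bool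
σU i j = σP i ∨ σP j

-- σ(P_k) is computed by a course-of-values table, so it is the unique function satisfying the
-- recursion; it therefore suffices to check that the candidate σ₇ (false exactly on residues
-- 1 and 2 mod 7) satisfies it.  For k = n + 4 with n ≡ 0, 1, 6 an option P_{n+1} or P_{n+2}
-- is a 𝒫-position, and for n ≡ 2, 3 the union P_1 ∪ P_n, resp. P_2 ∪ P_{n-1}, is one.  For
-- n ≡ 4, 5 both path options are 𝒩, and so are all unions P_i ∪ P_j with i + j = n + 1:
-- two 𝒫-paths have residues in {1, 2}, whose sums never reach n + 1 ≡ 5, 6.
module Submission where

open import Defs
open import Data.Bool using (Bool; true; false; not; _∨_; _∧_; T)
open import Data.Bool.Properties using (T?; T-∧)
open import Data.Empty using (⊥-elim)
open import Data.List using (_∷_; map; upTo)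
open import Data.List.Membership.Propositional using (_∈_)
open import Data.List.Membership.Propositional.Properties
  using (∈-map⁺; ∈-map⁻; ∈-filter⁺; ∈-filter⁻; ∈-upTo⁺; ∈-upTo⁻)
open import Data.List.Properties using (map-cong-local)
open import Data.List.Relation.Unary.All as All using (All; []; _∷_)
open import Data.List.Relation.Unary.All.Properties using (map⁺)
open import Data.List.Relation.Unary.Any using (here; there)
open import Data.Nat using (ℕ; zero; suc; _+_; _*_; _∸_; _≤_; _<_; _≤ᵇ_; z≤n; s≤s; _%_; _/_)
open import Data.Nat.DivMod using (m≡m%n+[m/n]*n; [m+kn]%n≡m%n; %-distribˡ-+; m%n≤m; m%n<n)
open import Data.Nat.Properties
  using (≤ᵇ⇒≤; ≤⇒≤ᵇ; m≤n⇒m<n∨m≡n; m+n∸m≡n; m+[n∸m]≡n; m≤m+n; m≤n+m; n≤1+n;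
         ≤-refl; ≤-trans; +-mono-≤; <⇒≱; +-comm; *-comm; module ≤-Reasoning)
open import Data.Product using (_×_; _,_; proj₁; ∃₂)
open import Data.Sum using (inj₁; inj₂)
open import Function using (_∘_)
open import Function.Bundles using (Equivalence)
open import Relation.Binary.PropositionalEquality
  using (_≡_; refl; sym; trans; cong; cong₂; subst; module ≡-Reasoning)

-- The filter predicate of `unions`, spelled out so that membership lemmas can name it.
admissible : ℕ → ℕ → Bool
admissible m i = (1 ≤ᵇ i) ∧ (i ≤ᵇ (m ∸ i)) ∧ (1 ≤ᵇ (m ∸ i))

∈-unions⁻ : ∀ {m p} → p ∈ unions m → ∃₂ λ i j → p ≡ union i j × i + j ≡ m
∈-unions⁻ {m} p∈ with i , i∈ , refl ← ∈-map⁻ _ p∈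
  with s≤s i≤m ← ∈-upTo⁻ (proj₁ (∈-filter⁻ (T? ∘ admissible m) {xs = upTo (suc m)} i∈))
  = i , m ∸ i , refl , m+[n∸m]≡n i≤m

union-∈-unions : ∀ {i j} → 1 ≤ i → i ≤ j → union i j ∈ unions (i + j)
union-∈-unions {i} {j} 1≤i i≤j =
  subst (λ k → union i k ∈ unions (i + j)) (m+n∸m≡n i j)
    (∈-map⁺ _ (∈-filter⁺ (T? ∘ admissible (i + j)) (∈-upTo⁺ (s≤s (m≤m+n i j)))
                         i-admissible))
  where
  i-admissible : T (admissible (i + j) i)
  i-admissible rewrite m+n∸m≡n i j =
    from T-∧ (≤⇒≤ᵇ 1≤i , from T-∧ (≤⇒≤ᵇ i≤j , ≤⇒≤ᵇ (≤-trans 1≤i i≤j)))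
    where open Equivalence

Below : ℕ → Pos → Set
Below k (path m)    = m < k
Below k (union i j) = i < k × j < k

options-below : ∀ k {p} → p ∈ options k → Below k p
options-below 1 (here refl) = s≤s z≤n
options-below 2 (here refl) = s≤s z≤n
options-below 3 (here refl) = s≤s z≤n
options-below 3 (there (here refl)) = s≤s (s≤s z≤n)
options-below (suc (suc (suc (suc n)))) (here refl) = m≤n+m (3 + n) 1
options-below (suc (suc (suc (suc n)))) (there (here refl)) = m≤n+m (2 + n) 2
options-below (suc (suc (suc (suc n)))) (there (there p∈))
  with i , j , refl , i+j≡1+n ← ∈-unions⁻ p∈
  = summand-below (m≤m+n i j) , summand-below (m≤n+m j i)
  where
  summand-below : ∀ {x} → x ≤ i + j → x < 4 + n
  summand-below {x} x≤i+j = s≤s (≤-trans (subst (x ≤_) i+j≡1+n x≤i+j) (m≤n+m (suc n) 2))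

valPos-cong : ∀ {f g k p} → (∀ {m} → m < k → f m ≡ g m) → Below k p →
              valPos f p ≡ valPos g p
valPos-cong {p = path m}    f≡g m<k         = f≡g m<k
valPos-cong {p = union i j} f≡g (i<k , j<k) = cong₂ _∨_ (f≡g i<k) (f≡g j<k)

step-cong : ∀ {f g} k → (∀ {m} → m < k → f m ≡ g m) → step f k ≡ step g k
step-cong k f≡g =
  cong (not ∘ minB) (map-cong-local (All.tabulate (valPos-cong f≡g ∘ options-below k)))

minB-false : ∀ {bs} → false ∈ bs → minB bs ≡ false
minB-false {b ∷ _} (here refl) = refl
minB-false {false ∷ _} (there f∈) = refl
minB-false {true ∷ _} (there f∈) = minB-false f∈

minB-true : ∀ {bs} → All (_≡ true) bs → minB bs ≡ true
minB-true [] = refl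
minB-true (refl ∷ bs≡true) = minB-true bs≡true

step-true : ∀ f k {p} → p ∈ options k → valPos f p ≡ false → step f k ≡ true
step-true f k p∈ p≡false =
  cong not (minB-false (subst (_∈ map (valPos f) (options k)) p≡false (∈-map⁺ (valPos f) p∈)))

step-false : ∀ f k → All (λ p → valPos f p ≡ true) (options k) → step f k ≡ false
step-false f k all-true = cong not (minB-true (map⁺ all-true))

σP-unique : ∀ g → g 0 ≡ true → (∀ k → step g (suc k) ≡ g (suc k)) → ∀ k → σP k ≡ g k
σP-unique g g0 g-step k = table≡g k ≤-refl
  where
  table≡g : ∀ n {m} → m ≤ n → table n m ≡ g m
  table≡g zero    z≤n = sym g0
  table≡g (suc n) {m} m≤1+n with m ≤ᵇ n in m≤ᵇn | m≤n⇒m<n∨m≡n m≤1+n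
  ... | true  | _                = table≡g n (≤ᵇ⇒≤ m n (subst T (sym m≤ᵇn) _))
  ... | false | inj₁ (s≤s m≤n)   = ⊥-elim (subst T m≤ᵇn (≤⇒≤ᵇ m≤n))
  ... | false | inj₂ refl        =
    trans (step-cong (suc n) (λ { (s≤s k≤n) → table≡g n k≤n })) (g-step n)

residueOutcome : ℕ → Bool
residueOutcome 1 = false
residueOutcome 2 = false
residueOutcome _ = true

σ₇ : ℕ → Bool
σ₇ m = residueOutcome (m % 7)

σ₇-periodic : ∀ r q → σ₇ (r + q * 7) ≡ residueOutcome (r % 7)
σ₇-periodic r q = cong residueOutcome ([m+kn]%n≡m%n r q 7)

residueOutcome-false⇒≤2 : ∀ r → residueOutcome r ≡ false → r ≤ 2
residueOutcome-false⇒≤2 1 _ = s≤s z≤n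
residueOutcome-false⇒≤2 2 _ = ≤-refl
residueOutcome-false⇒≤2 0 ()
residueOutcome-false⇒≤2 (suc (suc (suc _))) ()

σ₇-∨-true : ∀ i j → 4 < (i + j) % 7 → σ₇ i ∨ σ₇ j ≡ true
σ₇-∨-true i j 4<[i+j]%7 with σ₇ i in σ₇i | σ₇ j in σ₇j
... | true  | _     = refl
... | false | true  = refl
... | false | false = ⊥-elim (<⇒≱ 4<[i+j]%7 [i+j]%7≤4)
  where
  open ≤-Reasoning
  [i+j]%7≤4 : (i + j) % 7 ≤ 4
  [i+j]%7≤4 = begin
    (i + j) % 7             ≡⟨ %-distribˡ-+ i j 7 ⟩
    (i % 7 + j % 7) % 7     ≤⟨ m%n≤m (i % 7 + j % 7) 7 ⟩
    i % 7 + j % 7           ≤⟨ +-mono-≤ (residueOutcome-false⇒≤2 _ σ₇i)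
                                        (residueOutcome-false⇒≤2 _ σ₇j) ⟩
    2 + 2                   ∎

unions-σ₇-true : ∀ m → 4 < m % 7 → All (λ p → valPos σ₇ p ≡ true) (unions m)
unions-σ₇-true m 4<m%7 = All.tabulate λ p∈ → case-union (∈-unions⁻ p∈)
  where
  case-union : ∀ {p} → (∃₂ λ i j → p ≡ union i j × i + j ≡ m) → valPos σ₇ p ≡ true
  case-union (i , j , refl , refl) = σ₇-∨-true i j 4<m%7

σ₇-step-residue : ∀ r q → r < 7 → step σ₇ (4 + (r + q * 7)) ≡ σ₇ (4 + (r + q * 7))
σ₇-step-residue r q r<7 = trans (step-value r r<7) (sym (σ₇-periodic (4 + r) q))
  where
  unions-true : ∀ r → 4 < r % 7 → All (λ p → valPos σ₇ p ≡ true) (unions (r + q * 7))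
  unions-true r 4<r%7 = unions-σ₇-true _ (subst (4 <_) (sym ([m+kn]%n≡m%n r q 7)) 4<r%7)

  𝒫-option : ∀ r {p} → p ∈ options (4 + (r + q * 7)) → valPos σ₇ p ≡ false →
             step σ₇ (4 + (r + q * 7)) ≡ true
  𝒫-option r = step-true σ₇ (4 + (r + q * 7))

  all-𝒩 : ∀ r → All (λ p → valPos σ₇ p ≡ true) (options (4 + (r + q * 7))) →
          step σ₇ (4 + (r + q * 7)) ≡ false
  all-𝒩 r = step-false σ₇ (4 + (r + q * 7))

  step-value : ∀ r → r < 7 → step σ₇ (4 + (r + q * 7)) ≡ residueOutcome ((4 + r) % 7)
  step-value 0 _ = 𝒫-option 0 (there (here refl)) (σ₇-periodic 1 q)
  step-value 1 _ = 𝒫-option 1 (there (here refl)) (σ₇-periodic 2 q)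
  step-value 2 _ = 𝒫-option 2 (there (there (union-∈-unions ≤-refl (s≤s z≤n)))) (σ₇-periodic 2 q)
  step-value 3 _ =
    𝒫-option 3 (there (there (union-∈-unions (s≤s z≤n) (m≤m+n 2 _)))) (σ₇-periodic 2 q)
  step-value 4 _ = all-𝒩 4 (σ₇-periodic 6 q ∷ σ₇-periodic 5 q ∷ unions-true 5 ≤-refl)
  step-value 5 _ = all-𝒩 5 (σ₇-periodic 7 q ∷ σ₇-periodic 6 q ∷ unions-true 6 (n≤1+n 5))
  step-value 6 _ = 𝒫-option 6 (here refl) (σ₇-periodic 8 q)
  step-value (suc (suc (suc (suc (suc (suc (suc _)))))))
    (s≤s (s≤s (s≤s (s≤s (s≤s (s≤s (s≤s ())))))))

σ₇-step : ∀ k → step σ₇ (suc k) ≡ σ₇ (suc k)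
σ₇-step 0 = refl
σ₇-step 1 = refl
σ₇-step 2 = refl
σ₇-step (suc (suc (suc n))) =
  subst (λ m → step σ₇ (4 + m) ≡ σ₇ (4 + m)) (sym (m≡m%n+[m/n]*n n 7))
        (σ₇-step-residue (n % 7) (n / 7) (m%n<n n 7))

σP≡σ₇ : ∀ k → σP k ≡ σ₇ k
σP≡σ₇ = σP-unique σ₇ refl σ₇-step

σP-7n+a : ∀ n a → σP (7 * n + a) ≡ residueOutcome (a % 7)
σP-7n+a n a = begin
  σP (7 * n + a) ≡⟨ σP≡σ₇ (7 * n + a) ⟩
  σ₇ (7 * n + a) ≡⟨ cong σ₇ (trans (+-comm (7 * n) a) (cong (a +_) (*-comm 7 n))) ⟩
  σ₇ (a + n * 7) ≡⟨ σ₇-periodic a n ⟩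
  residueOutcome (a % 7) ∎
  where open ≡-Reasoning

residueOutcome-true : ∀ a → 3 ≤ a → a ≤ 7 → residueOutcome (a % 7) ≡ true
residueOutcome-true 3 _ _ = refl
residueOutcome-true 4 _ _ = refl
residueOutcome-true 5 _ _ = refl
residueOutcome-true 6 _ _ = refl
residueOutcome-true 7 _ _ = refl
residueOutcome-true 0 () _
residueOutcome-true 1 (s≤s ()) _
residueOutcome-true 2 (s≤s (s≤s ())) _
residueOutcome-true (suc (suc (suc (suc (suc (suc (suc (suc _)))))))) _
  (s≤s (s≤s (s≤s (s≤s (s≤s (s≤s (s≤s ())))))))

theorem7 : (n : ℕ) →
    (σP (7 * n + 1) ≡ false × σP (7 * n + 2) ≡ false)
    × ((a : ℕ) → 3 ≤ a → a ≤ 7 → σP (7 * n + a) ≡ true)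
theorem7 n =
  (σP-7n+a n 1 , σP-7n+a n 2) ,
  λ a 3≤a a≤7 → trans (σP-7n+a n a) (residueOutcome-true a 3≤a a≤7)
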